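{- Let $q$ be a prime power, $n$ a positive integer and $k'\ge2$ an integer. Let $S$ be a $k'$-dimensional $\mathbb{F}_q$-subspace of $\mathbb{F}_{q^n}$, $T=\langle 1,\mu\rangle_{\mathbb{F}_q}$ for some $\mu\in\mathbb{F}_{q^n}\setminus\mathbb{F}_q$, and $U=S\times T$. Then the number of points of weight two in $L_U$ different from $\langle(1,0)\rangle_{\mathbb{F}_{q^n}}$ is $q^j$, where $j=\dim_{\mathbb{F}_q}(S\cap\mu S)$.
   Context: For an $\mathbb{F}_q$-subspace $U\neq\{0\}$ of $\mathbb{F}_{q^n}^2$, $L_U=\{\langle u\rangle_{\mathbb{F}_{q^n}}: u\in U\setminus\{0\}\}\subseteq\mathrm{PG}(1,q^n)$; the weight of $P=\langle v\rangle_{\mathbb{F}_{q^n}}$ in $L_U$ is $\dim_{\mathbb{F}_q}(U\cap\langle v\rangle_{\mathbb{F}_{q^n}})$. For $S,T\subseteq\mathbb{F}_{q^n}$, $S\times T=\{(s,t):s\in S,t\in T\}$ and $\mu S=\{\mu s:s\in S\}$. -}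

module Defs where

open import Data.Nat using (ℕ; zero; suc; _^_)
open import Data.Nat.Primality using (Prime)
open import Data.Fin using (Fin; zero; suc)
open import Data.Product using (Σ; ∃; _×_; _,_)
open import Relation.Nullary using (¬_)
open import Relation.Binary.PropositionalEquality using (_≡_)
open import Algebra.Structures using (IsCommutativeRing)

IsPrimePower : ℕ → Set
IsPrimePower q = Σ ℕ λ p → Σ ℕ λ e → Prime p × q ≡ p ^ suc e

-- A finite field: a commutative ring (with propositional equality), 0 ≠ 1,
-- every nonzero element invertible, and finitely many elements
-- (finiteness/cardinality is expressed separately via HasSize below).
record Field : Set₁ where
  infixl 6 _+_
  infixl 7 _*_
  field
    Carrier : Set
    _+_ _*_ : Carrier → Carrier → Carrier
    -_ : Carrier → Carrier
    0# 1# : Carrier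
    isCommutativeRing : IsCommutativeRing _≡_ _+_ _*_ -_ 0# 1#
    0≢1 : ¬ (0# ≡ 1#)
    inverse : ∀ x → ¬ (x ≡ 0#) → Σ Carrier λ y → x * y ≡ 1#

HasSize : {A : Set} → (A → Set) → ℕ → Set
HasSize {A} P m =
  Σ (Fin m → A) λ f →
    (∀ i → P (f i)) ×
    (∀ i j → f i ≡ f j → i ≡ j) ×
    (∀ x → P x → Σ (Fin m) λ i → f i ≡ x)

module _ (F : Field) where
  open Field F

  record IsSubfield (K : Carrier → Set) : Set where
    field
      0∈ : K 0#
      1∈ : K 1#
      +-closed : ∀ {x y} → K x → K y → K (x + y)
      *-closed : ∀ {x y} → K x → K y → K (x * y)
      neg-closed : ∀ {x} → K x → K (- x)
      inv-closed : ∀ {x y} → K x → x * y ≡ 1# → K y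

  V2 : Set
  V2 = Carrier × Carrier

  _⊕_ : V2 → V2 → V2
  (a , b) ⊕ (c , d) = (a + c , b + d)

  _·_ : Carrier → V2 → V2
  c · (a , b) = (c * a , c * b)

  0V : V2
  0V = (0# , 0#)

  record VecOps (V : Set) : Set where
    field
      vadd : V → V → V
      vzero : V
      vscale : Carrier → V → V

  F1 : VecOps Carrier
  F1 = record { vadd = _+_ ; vzero = 0# ; vscale = _*_ }

  F2 : VecOps V2
  F2 = record { vadd = _⊕_ ; vzero = 0V ; vscale = _·_ }

  module _ {V : Set} (ops : VecOps V) (K : Carrier → Set) where
    open VecOps ops

    lincomb : ∀ {d} → (Fin d → Carrier) → (Fin d → V) → V
    lincomb {zero} c w = vzero
    lincomb {suc d} c w = vadd (vscale (c zero) (w zero)) (lincomb (λ i → c (suc i)) (λ i → w (suc i)))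

    record IsSubspace (W : V → Set) : Set where
      field
        zero∈ : W vzero
        add-closed : ∀ {x y} → W x → W y → W (vadd x y)
        scale-closed : ∀ {a x} → K a → W x → W (vscale a x)

    Independent : ∀ {d} → (Fin d → V) → Set
    Independent {d} w = (c : Fin d → Carrier) → (∀ i → K (c i)) →
      lincomb c w ≡ vzero → ∀ i → c i ≡ 0#

    Spans : ∀ {d} → (V → Set) → (Fin d → V) → Set
    Spans {d} W w = ∀ x → W x →
      Σ (Fin d → Carrier) λ c → (∀ i → K (c i)) × lincomb c w ≡ x

    HasDim : (V → Set) → ℕ → Set
    HasDim W d = Σ (Fin d → V) λ w → (∀ i → W (w i)) × Independent w × Spans W w

  Proportional : V2 → V2 → Set
  Proportional x y = Σ Carrier λ c → ¬ (c ≡ 0#) × x ≡ c · y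

  FSpan : V2 → V2 → Set
  FSpan v u = Σ Carrier λ c → u ≡ c · v

  HasWeight : (K : Carrier → Set) → (U : V2 → Set) → V2 → ℕ → Set
  HasWeight K U v w = HasDim F2 K (λ u → U u × FSpan v u) w

  -- The number of points of PG(1,F) satisfying the (scalar-invariant)
  -- property P is m: m pairwise non-proportional nonzero representatives
  -- satisfying P, such that every nonzero vector satisfying P is
  -- proportional to one of them.
  NumPoints : (V2 → Set) → ℕ → Set
  NumPoints P m =
    Σ (Fin m → V2) λ r →
      (∀ i → ¬ (r i ≡ 0V)) ×
      (∀ i → P (r i)) ×
      (∀ i j → Proportional (r i) (r j) → i ≡ j) ×
      (∀ x → ¬ (x ≡ 0V) → P x → Σ (Fin m) λ i → Proportional x (r i))

  _×ˢ_ : (Carrier → Set) → (Carrier → Set) → V2 → Set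
  (S ×ˢ T) (s , t) = S s × T t

  scaleSet : Carrier → (Carrier → Set) → Carrier → Set
  scaleSet μ S x = Σ Carrier λ s → S s × x ≡ μ * s

  span1μ : (K : Carrier → Set) → Carrier → Carrier → Set
  span1μ K μ t = Σ Carrier λ a → Σ Carrier λ b → K a × K b × t ≡ a + b * μ

{-# OPTIONS --safe #-}
module Submission where

open import Defs
open import Data.Nat using (ℕ; zero; suc; _^_; _≤_)
open import Data.Product using (Σ; _×_; _,_; proj₁; proj₂)
open import Data.Unit using (⊤)
open import Relation.Nullary using (¬_; yes; no)

open import Algebra.Bundles using (CommutativeRing)
open import Algebra.Structures using (IsCommutativeRing)
open import Algebra.Solver.Ring.AlmostCommutativeRing using (fromCommutativeRing; _-Raw-AlmostCommutative⟶_)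
open import Data.Empty using (⊥-elim)
open import Data.Fin.Base using (Fin; zero; suc; finToFun; funToFin; combine)
open import Data.Fin.Properties as Finₚ using (funToFin-finToFin; finToFun-funToFin)
open import Data.Integer.Base as ℤ using (ℤ; -[1+_]; _◃_; sign; ∣_∣)
import Data.Integer.Properties as ℤₚ
open import Data.Maybe.Base using (Maybe; just; nothing)
import Data.Nat.Base as ℕ
import Data.Nat.Properties as ℕₚ
open import Data.Sign.Base as Sign using (Sign)
open import Data.Vec.Functional using (_∷_; [])
open import Function.Base using (_∘_)
open import Relation.Binary.Definitions using (DecidableEquality)
open import Relation.Binary.PropositionalEquality
open import Relation.Nullary.Decidable using (map′)

-- A point of PG(1, q^n) other than ⟨(1,0)⟩ (written ∞) is ⟨(λ,1)⟩ for a unique λ.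
-- The vectors of U = S × T on it are the t·(λ,1) with t ∈ T and tλ ∈ S; since two
-- K-independent elements of T = ⟨1,μ⟩ span T, the weight is 2 exactly when Tλ ⊆ S,
-- i.e. when λ ∈ S and μλ ∈ S. So the points of weight two are counted by μ⁻¹(S ∩ μS),
-- a K-space of dimension j, which has q^j elements.

-- Algebra.Solver.Ring needs coefficients with decidable equality; the integers, which
-- map into every ring, provide them for any commutative ring whose equality is _≡_.
module ℤ-CoefficientRingSolver
  {A : Set} {add mul : A → A → A} {neg : A → A} {0ᴬ 1ᴬ : A}
  (isCommutativeRing : IsCommutativeRing _≡_ add mul neg 0ᴬ 1ᴬ) where

  private
    R : CommutativeRing _ _
    R = record { isCommutativeRing = isCommutativeRing }

    open CommutativeRing R using (_+_; _*_; -_; 0#; 1#; ring; semiring; +-assoc; +-comm; +-identityˡ; +-identityʳ; -‿inverseʳ)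
    open import Algebra.Properties.Ring ring using (-‿involutive; -‿distribˡ-*; -‿distribʳ-*; -0#≈0#; -‿+-comm)
    open import Algebra.Properties.Semiring.Mult.TCOptimised semiring
      using (×-homo-+; ×1-homo-*; 1+×) renaming (_×_ to _×ᴬ_)

    signed : Sign → A → A
    signed Sign.+ x = x
    signed Sign.- x = - x

    ⟦_⟧ : ℤ → A
    ⟦ i ⟧ = signed (sign i) (∣ i ∣ ×ᴬ 1#)

    ◃-homo : ∀ s n → ⟦ s ◃ n ⟧ ≡ signed s (n ×ᴬ 1#)
    ◃-homo Sign.+ zero    = refl
    ◃-homo Sign.- zero    = sym -0#≈0#
    ◃-homo Sign.+ (suc n) = refl
    ◃-homo Sign.- (suc n) = refl

    signed-* : ∀ s t x y → signed (s Sign.* t) (x * y) ≡ signed s x * signed t y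
    signed-* Sign.+ Sign.+ x y = refl
    signed-* Sign.+ Sign.- x y = -‿distribʳ-* x y
    signed-* Sign.- Sign.+ x y = -‿distribˡ-* x y
    signed-* Sign.- Sign.- x y =
      trans (sym (-‿involutive (x * y)))
            (trans (cong -_ (-‿distribʳ-* x y)) (-‿distribˡ-* x (- y)))

    1+a-[1+b]≡a-b : ∀ a b → (1# + a) + - (1# + b) ≡ a + - b
    1+a-[1+b]≡a-b a b = begin
      (1# + a) + - (1# + b)     ≡⟨ cong ((1# + a) +_) (sym (-‿+-comm 1# b)) ⟩
      (1# + a) + (- 1# + - b)   ≡⟨ cong (_+ (- 1# + - b)) (+-comm 1# a) ⟩
      (a + 1#) + (- 1# + - b)   ≡⟨ +-assoc a 1# _ ⟩
      a + (1# + (- 1# + - b))   ≡⟨ cong (a +_) (sym (+-assoc 1# (- 1#) (- b))) ⟩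
      a + ((1# + - 1#) + - b)   ≡⟨ cong (λ z → a + (z + - b)) (-‿inverseʳ 1#) ⟩
      a + (0# + - b)            ≡⟨ cong (a +_) (+-identityˡ (- b)) ⟩
      a + - b                   ∎
      where open ≡-Reasoning

    ⊖-homo : ∀ m n → ⟦ m ℤ.⊖ n ⟧ ≡ (m ×ᴬ 1#) + - (n ×ᴬ 1#)
    ⊖-homo zero    zero    = sym (trans (+-identityˡ _) -0#≈0#)
    ⊖-homo zero    (suc n) = trans (cong ⟦_⟧ (ℤₚ.⊖-< {0} {suc n} (ℕ.s≤s ℕ.z≤n))) (sym (+-identityˡ _))
    ⊖-homo (suc m) zero    = sym (trans (cong (suc m ×ᴬ 1# +_) -0#≈0#) (+-identityʳ _))
    ⊖-homo (suc m) (suc n) = trans (cong ⟦_⟧ (ℤₚ.[1+m]⊖[1+n]≡m⊖n m n))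
                               (trans (⊖-homo m n) (sym (trans (cong₂ (λ a b → a + - b) (1+× m 1#) (1+× n 1#))
                                                                (1+a-[1+b]≡a-b _ _))))

    +-homo : ∀ i j → ⟦ i ℤ.+ j ⟧ ≡ ⟦ i ⟧ + ⟦ j ⟧
    +-homo (ℤ.+ m)    (ℤ.+ n)    = ×-homo-+ 1# m n
    +-homo (ℤ.+ m)    -[1+ n ] = ⊖-homo m (suc n)
    +-homo -[1+ m ] (ℤ.+ n)    = trans (⊖-homo n (suc m)) (+-comm _ _)
    +-homo -[1+ m ] -[1+ n ] = begin
      - (suc (suc (m ℕ.+ n)) ×ᴬ 1#)          ≡⟨ cong (λ k → - (suc k ×ᴬ 1#)) (sym (ℕₚ.+-suc m n)) ⟩
      - ((suc m ℕ.+ suc n) ×ᴬ 1#)            ≡⟨ cong -_ (×-homo-+ 1# (suc m) (suc n)) ⟩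
      - (suc m ×ᴬ 1# + suc n ×ᴬ 1#)           ≡⟨ sym (-‿+-comm _ _) ⟩
      - (suc m ×ᴬ 1#) + - (suc n ×ᴬ 1#)       ∎
      where open ≡-Reasoning

    *-homo : ∀ i j → ⟦ i ℤ.* j ⟧ ≡ ⟦ i ⟧ * ⟦ j ⟧
    *-homo i j = begin
      ⟦ (sign i Sign.* sign j) ◃ (∣ i ∣ ℕ.* ∣ j ∣) ⟧                  ≡⟨ ◃-homo (sign i Sign.* sign j) (∣ i ∣ ℕ.* ∣ j ∣) ⟩
      signed (sign i Sign.* sign j) ((∣ i ∣ ℕ.* ∣ j ∣) ×ᴬ 1#)        ≡⟨ cong (signed (sign i Sign.* sign j)) (×1-homo-* ∣ i ∣ ∣ j ∣) ⟩
      signed (sign i Sign.* sign j) ((∣ i ∣ ×ᴬ 1#) * (∣ j ∣ ×ᴬ 1#))   ≡⟨ signed-* (sign i) (sign j) _ _ ⟩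
      ⟦ i ⟧ * ⟦ j ⟧                                               ∎
      where open ≡-Reasoning

    -‿homo : ∀ i → ⟦ ℤ.- i ⟧ ≡ - ⟦ i ⟧
    -‿homo -[1+ n ]      = sym (-‿involutive _)
    -‿homo (ℤ.+ zero)      = sym -0#≈0#
    -‿homo (ℤ.+ (suc n))   = refl

    homomorphism : ℤ.+-*-rawRing -Raw-AlmostCommutative⟶ fromCommutativeRing R
    homomorphism = record
      { ⟦_⟧ = ⟦_⟧ ; +-homo = +-homo ; *-homo = *-homo ; -‿homo = -‿homo
      ; 0-homo = refl ; 1-homo = refl }

    ⟦⟧-equal? : ∀ i j → Maybe (⟦ i ⟧ ≡ ⟦ j ⟧)
    ⟦⟧-equal? i j with i ℤₚ.≟ j
    ... | yes refl = just refl
    ... | no _     = nothing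

  open import Algebra.Solver.Ring ℤ.+-*-rawRing (fromCommutativeRing R) homomorphism ⟦⟧-equal? public

  :0 :1 : ∀ {n} → Polynomial n
  :0 = con (ℤ.+ 0)
  :1 = con (ℤ.+ 1)


finite⇒≟ : {A : Set} {m : ℕ} → HasSize {A} (λ _ → ⊤) m → DecidableEquality A
finite⇒≟ (f , _ , f-injective , f-surjective) x y with f-surjective x _ | f-surjective y _
... | i , refl | k , refl = map′ (cong f) (f-injective i k) (i Finₚ.≟ k)

funToFin-cong : ∀ {m n} {f g : Fin m → Fin n} → f ≗ g → funToFin f ≡ funToFin g
funToFin-cong {zero}  f≗g = refl
funToFin-cong {suc m} f≗g = cong₂ combine (f≗g zero) (funToFin-cong (f≗g ∘ suc))

finToFun-injective : ∀ {m n} {a b : Fin (n ^ m)} → finToFun {n} {m} a ≗ finToFun b → a ≡ b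
finToFun-injective {m} {n} {a} {b} a≗b = begin
  a                                       ≡⟨ funToFin-finToFin {m} {n} a ⟨
  funToFin {m} {n} (finToFun a)           ≡⟨ funToFin-cong {m} {n} a≗b ⟩
  funToFin {m} {n} (finToFun b)           ≡⟨ funToFin-finToFin {m} {n} b ⟩
  b                                       ∎
  where open ≡-Reasoning

module _ (F : Field) where
  open Field F

  commutativeRing : CommutativeRing _ _
  commutativeRing = record { isCommutativeRing = isCommutativeRing }

  open CommutativeRing commutativeRing
    using (+-identityʳ; *-identityˡ; *-identityʳ; *-assoc; *-comm; zeroˡ; zeroʳ; -‿inverseʳ; distribˡ; ring)
  open import Algebra.Properties.Ring ring using (-0#≈0#; -‿injective; +-inverseʳ-unique; x∙y⁻¹≈ε⇒x≈y)
  open ℤ-CoefficientRingSolver isCommutativeRing using (solve; _:=_; _:+_; _:*_; :-_; :0; :1)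

  inv : (x : Carrier) → x ≢ 0# → Carrier
  inv x x≢0 = proj₁ (inverse x x≢0)

  module _ {x : Carrier} (x≢0 : x ≢ 0#) where
    *-inverseʳ : x * inv x x≢0 ≡ 1#
    *-inverseʳ = proj₂ (inverse x x≢0)

    *-inverseˡ : inv x x≢0 * x ≡ 1#
    *-inverseˡ = trans (*-comm _ x) *-inverseʳ

    inv-*-cancelˡ : ∀ y → inv x x≢0 * (x * y) ≡ y
    inv-*-cancelˡ y = trans (sym (*-assoc _ x y)) (trans (cong (_* y) *-inverseˡ) (*-identityˡ y))

    *-inv-cancelˡ : ∀ y → x * (inv x x≢0 * y) ≡ y
    *-inv-cancelˡ y = trans (sym (*-assoc x _ y)) (trans (cong (_* y) *-inverseʳ) (*-identityˡ y))

  ·-assoc : ∀ c d v → _·_ F c (_·_ F d v) ≡ _·_ F (c * d) v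
  ·-assoc c d (v₁ , v₂) = cong₂ _,_ (sym (*-assoc c d v₁)) (sym (*-assoc c d v₂))

  module _ {V : Set} (ops : VecOps F V) (K : Carrier → Set) where
    open VecOps ops
    open IsSubspace using (zero∈; add-closed; scale-closed)

    IsSubspace-∩ : ∀ {W W′} → IsSubspace F ops K W → IsSubspace F ops K W′ →
                   IsSubspace F ops K (λ v → W v × W′ v)
    IsSubspace-∩ W-sub W′-sub = record
      { zero∈ = zero∈ W-sub , zero∈ W′-sub
      ; add-closed = λ (x∈W , x∈W′) (y∈W , y∈W′) → add-closed W-sub x∈W y∈W , add-closed W′-sub x∈W′ y∈W′
      ; scale-closed = λ a∈K (x∈W , x∈W′) → scale-closed W-sub a∈K x∈W , scale-closed W′-sub a∈K x∈W′
      }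

    lincomb-∈ : ∀ {W} → IsSubspace F ops K W → ∀ {d} (c : Fin d → Carrier) (w : Fin d → V) →
                (∀ i → K (c i)) → (∀ i → W (w i)) → W (lincomb F ops K c w)
    lincomb-∈ W-sub {zero}  c w c∈K w∈W = zero∈ W-sub
    lincomb-∈ W-sub {suc d} c w c∈K w∈W =
      add-closed W-sub (scale-closed W-sub (c∈K zero) (w∈W zero))
        (lincomb-∈ W-sub (c ∘ suc) (w ∘ suc) (c∈K ∘ suc) (w∈W ∘ suc))

    lincomb-congˡ : ∀ {d} {c c′ : Fin d → Carrier} (w : Fin d → V) → c ≗ c′ →
                    lincomb F ops K c w ≡ lincomb F ops K c′ w
    lincomb-congˡ {zero}  w c≗c′ = refl
    lincomb-congˡ {suc d} w c≗c′ =
      cong₂ vadd (cong (λ a → vscale a (w zero)) (c≗c′ zero)) (lincomb-congˡ (w ∘ suc) (c≗c′ ∘ suc))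

    HasDim-cong : ∀ {W W′ d} → (∀ {v} → W v → W′ v) → (∀ {v} → W′ v → W v) →
                  HasDim F ops K W d → HasDim F ops K W′ d
    HasDim-cong W⇒W′ W′⇒W (w , w∈W , w-independent , w-spans) =
      w , W⇒W′ ∘ w∈W , w-independent , λ v v∈W′ → w-spans v (W′⇒W v∈W′)

  module _ {K : Carrier → Set} where
    open IsSubspace using (zero∈; add-closed; scale-closed)

    scaleSet-isSubspace : ∀ {S} μ → IsSubspace F (F1 F) K S → IsSubspace F (F1 F) K (scaleSet F μ S)
    scaleSet-isSubspace μ S-sub = record
      { zero∈ = 0# , zero∈ S-sub , sym (zeroʳ μ)
      ; add-closed = λ (s , s∈S , x≡μs) (s′ , s′∈S , y≡μs′) →
          s + s′ , add-closed S-sub s∈S s′∈S , trans (cong₂ _+_ x≡μs y≡μs′) (sym (distribˡ μ s s′))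
      ; scale-closed = λ {a} a∈K (s , s∈S , x≡μs) →
          a * s , scale-closed S-sub a∈K s∈S ,
          trans (cong (a *_) x≡μs) (solve 3 (λ a μ s → a :* (μ :* s) := μ :* (a :* s)) refl a μ s)
      }

    lincomb-− : ∀ {d} (c c′ w : Fin d → Carrier) →
                lincomb F (F1 F) K c w + - lincomb F (F1 F) K c′ w ≡ lincomb F (F1 F) K (λ i → c i + - c′ i) w
    lincomb-− {zero}  c c′ w = -‿inverseʳ 0#
    lincomb-− {suc d} c c′ w = trans
      (solve 5 (λ a x a′ r r′ → (a :* x :+ r) :+ (:- (a′ :* x :+ r′)) := (a :+ (:- a′)) :* x :+ (r :+ (:- r′)))
        refl (c zero) (w zero) (c′ zero) (lincomb F (F1 F) K (c ∘ suc) (w ∘ suc)) (lincomb F (F1 F) K (c′ ∘ suc) (w ∘ suc)))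
      (cong ((c zero + - c′ zero) * w zero +_) (lincomb-− (c ∘ suc) (c′ ∘ suc) (w ∘ suc)))

    lincomb-*ʳ : ∀ {d} (c t : Fin d → Carrier) x →
                 lincomb F (F1 F) K c t * x ≡ lincomb F (F1 F) K c (λ i → t i * x)
    lincomb-*ʳ {zero}  c t x = zeroˡ x
    lincomb-*ʳ {suc d} c t x = trans
      (solve 4 (λ a s r x → (a :* s :+ r) :* x := a :* (s :* x) :+ r :* x) refl (c zero) (t zero) _ x)
      (cong (c zero * (t zero * x) +_) (lincomb-*ʳ (c ∘ suc) (t ∘ suc) x))

    lincomb-scaled : ∀ {d} (c t : Fin d → Carrier) {w : Fin d → V2 F} (v : V2 F) → (∀ i → w i ≡ _·_ F (t i) v) →
                     lincomb F (F2 F) K c w ≡ _·_ F (lincomb F (F1 F) K c t) v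
    lincomb-scaled {zero}  c t (v₁ , v₂) w≡tv = cong₂ _,_ (sym (zeroˡ v₁)) (sym (zeroˡ v₂))
    lincomb-scaled {suc d} c t {w} v@(v₁ , v₂) w≡tv = begin
      _⊕_ F (_·_ F (c zero) (w zero)) (lincomb F (F2 F) K (c ∘ suc) (w ∘ suc))
        ≡⟨ cong₂ (λ u r → _⊕_ F (_·_ F (c zero) u) r) (w≡tv zero) (lincomb-scaled (c ∘ suc) (t ∘ suc) v (w≡tv ∘ suc)) ⟩
      _⊕_ F (_·_ F (c zero) (_·_ F (t zero) v)) (_·_ F r v)
        ≡⟨ cong₂ _,_ (distributes v₁) (distributes v₂) ⟩
      _·_ F (c zero * t zero + r) v
        ∎
      where
        open ≡-Reasoning
        r : Carrier
        r = lincomb F (F1 F) K (c ∘ suc) (t ∘ suc)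
        distributes : ∀ x → c zero * (t zero * x) + r * x ≡ (c zero * t zero + r) * x
        distributes x = solve 4 (λ a s r x → a :* (s :* x) :+ r :* x := (a :* s :+ r) :* x) refl (c zero) (t zero) r x

  module _ {K : Carrier → Set} (K-subfield : IsSubfield F K) where
    open IsSubfield K-subfield

    lincomb-injective : ∀ {d} {w : Fin d → Carrier} → Independent F (F1 F) K w →
                        ∀ {c c′} → (∀ i → K (c i)) → (∀ i → K (c′ i)) →
                        lincomb F (F1 F) K c w ≡ lincomb F (F1 F) K c′ w → c ≗ c′
    lincomb-injective {w = w} w-independent {c} {c′} c∈K c′∈K eq =
      λ i → x∙y⁻¹≈ε⇒x≈y (c i) (c′ i) (w-independent (λ i → c i + - c′ i) c-c′∈K c-c′↦0 i)
      where
        c-c′∈K : ∀ i → K (c i + - c′ i)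
        c-c′∈K i = +-closed (c∈K i) (neg-closed (c′∈K i))

        c-c′↦0 : lincomb F (F1 F) K (λ i → c i + - c′ i) w ≡ 0#
        c-c′↦0 = trans (sym (lincomb-− {K = K} c c′ w)) (trans (cong (_+ - _) eq) (-‿inverseʳ _))

    subspace-size : ∀ {q W d} → HasSize K q → IsSubspace F (F1 F) K W → HasDim F (F1 F) K W d →
                    HasSize W (q ^ d)
    subspace-size {q} {W} {d} (k , k∈K , k-injective , k-surjective) W-sub (b , b∈W , b-independent , b-spans) =
      element , element∈W , element-injective , element-surjective
      where
        coordinates : Fin (q ^ d) → Fin d → Carrier
        coordinates a = k ∘ finToFun a

        element : Fin (q ^ d) → Carrier
        element a = lincomb F (F1 F) K (coordinates a) b

        element∈W : ∀ a → W (element a)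
        element∈W a = lincomb-∈ (F1 F) K W-sub (coordinates a) b (k∈K ∘ finToFun a) b∈W

        element-injective : ∀ a a′ → element a ≡ element a′ → a ≡ a′
        element-injective a a′ eq = finToFun-injective λ i →
          k-injective _ _ (lincomb-injective b-independent (k∈K ∘ finToFun a) (k∈K ∘ finToFun a′) eq i)

        element-surjective : ∀ x → W x → Σ (Fin (q ^ d)) λ a → element a ≡ x
        element-surjective x x∈W with b-spans x x∈W
        ... | c , c∈K , b[c]≡x = funToFin index , trans (lincomb-congˡ (F1 F) K b coordinates≗c) b[c]≡x
          where
            index : Fin d → Fin q
            index i = proj₁ (k-surjective (c i) (c∈K i))

            coordinates≗c : coordinates (funToFin index) ≗ c
            coordinates≗c i = trans (cong k (finToFun-funToFin index i)) (proj₂ (k-surjective (c i) (c∈K i)))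

  HasSize-scale : ∀ {W : Carrier → Set} {m c} → c ≢ 0# → HasSize W m → HasSize (λ x → W (c * x)) m
  HasSize-scale {W} {c = c} c≢0 (f , f∈W , f-injective , f-surjective) =
    (λ i → inv c c≢0 * f i) , element∈W , element-injective , element-surjective
    where
      element∈W : ∀ i → W (c * (inv c c≢0 * f i))
      element∈W i = subst W (sym (*-inv-cancelˡ c≢0 (f i))) (f∈W i)

      element-injective : ∀ i j → inv c c≢0 * f i ≡ inv c c≢0 * f j → i ≡ j
      element-injective i j eq = f-injective i j
        (trans (sym (*-inv-cancelˡ c≢0 (f i))) (trans (cong (c *_) eq) (*-inv-cancelˡ c≢0 (f j))))

      element-surjective : ∀ x → W (c * x) → Σ (Fin _) λ i → inv c c≢0 * f i ≡ x
      element-surjective x cx∈W with f-surjective (c * x) cx∈W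
      ... | i , fi≡cx = i , trans (cong (inv c c≢0 *_) fi≡cx) (inv-*-cancelˡ c≢0 x)

  scaleSet-cancel : ∀ {S μ x} → μ ≢ 0# → scaleSet F μ S (μ * x) → S x
  scaleSet-cancel {S} {μ} {x} μ≢0 (s , s∈S , μx≡μs) = subst S s≡x s∈S
    where
      s≡x : s ≡ x
      s≡x = trans (sym (inv-*-cancelˡ μ≢0 s)) (trans (cong (inv μ μ≢0 *_) (sym μx≡μs)) (inv-*-cancelˡ μ≢0 x))

  inv≢0 : ∀ {x} (x≢0 : x ≢ 0#) → inv x x≢0 ≢ 0#
  inv≢0 {x} x≢0 inv≡0 = 0≢1 (trans (sym (zeroʳ x)) (trans (cong (x *_) (sym inv≡0)) (*-inverseʳ x≢0)))

  Proportional-sym : ∀ {x y} → Proportional F x y → Proportional F y x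
  Proportional-sym {x} {y@(y₁ , y₂)} (d , d≢0 , x≡dy) = inv d d≢0 , inv≢0 d≢0 , (begin
    y                                      ≡⟨ cong₂ _,_ (inv-*-cancelˡ d≢0 y₁) (inv-*-cancelˡ d≢0 y₂) ⟨
    _·_ F (inv d d≢0) (_·_ F d y)          ≡⟨ cong (_·_ F (inv d d≢0)) x≡dy ⟨
    _·_ F (inv d d≢0) x                    ∎)
    where open ≡-Reasoning

  FSpan-proportional : ∀ {x y} → Proportional F x y → ∀ {u} → FSpan F x u → FSpan F y u
  FSpan-proportional {y = y} (d , _ , x≡dy) (c , u≡cx) =
    c * d , trans u≡cx (trans (cong (_·_ F c) x≡dy) (·-assoc c d y))

  HasWeight-proportional : ∀ {K U x y w} → Proportional F x y → HasWeight F K U x w → HasWeight F K U y w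
  HasWeight-proportional {K} x∼y = HasDim-cong (F2 F) K
    (λ (u∈U , u∈⟨x⟩) → u∈U , FSpan-proportional x∼y u∈⟨x⟩)
    (λ (u∈U , u∈⟨y⟩) → u∈U , FSpan-proportional (Proportional-sym x∼y) u∈⟨y⟩)

  affine≁∞ : ∀ l → ¬ Proportional F (l , 1#) (1# , 0#)
  affine≁∞ l (c , _ , eq) = 0≢1 (trans (sym (zeroʳ c)) (sym (cong proj₂ eq)))

  numPoints-affine : ∀ {P : V2 F → Set} {Λ : Carrier → Set} {m} → HasSize Λ m →
                     (∀ {l} → Λ l → P (l , 1#)) →
                     (∀ x → x ≢ 0V F → P x → Σ Carrier λ l → Λ l × Proportional F x (l , 1#)) →
                     NumPoints F P m
  numPoints-affine {P} {Λ} {m} (f , f∈Λ , f-injective , f-surjective) Λ⇒P P⇒Λ =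
    point , point≢0 , Λ⇒P ∘ f∈Λ , point-injective , point-complete
    where
      point : Fin m → V2 F
      point i = f i , 1#

      point≢0 : ∀ i → point i ≢ 0V F
      point≢0 i eq = 0≢1 (sym (cong proj₂ eq))

      point-injective : ∀ i j → Proportional F (point i) (point j) → i ≡ j
      point-injective i j (c , _ , eq) = f-injective i j (begin
        f i        ≡⟨ cong proj₁ eq ⟩
        c * f j    ≡⟨ cong (_* f j) c≡1 ⟩
        1# * f j   ≡⟨ *-identityˡ (f j) ⟩
        f j        ∎)
        where
          open ≡-Reasoning
          c≡1 : c ≡ 1#
          c≡1 = trans (sym (*-identityʳ c)) (sym (cong proj₂ eq))

      point-complete : ∀ x → x ≢ 0V F → P x → Σ (Fin m) λ i → Proportional F x (point i)
      point-complete x x≢0 Px with P⇒Λ x x≢0 Px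
      ... | l , l∈Λ , x∼l with f-surjective l l∈Λ
      ... | i , refl = i , x∼l

  affine-representative : DecidableEquality Carrier → ∀ x → x ≢ 0V F → ¬ Proportional F x (1# , 0#) →
                          Σ Carrier λ l → Proportional F x (l , 1#)
  affine-representative _≟_ (x₁ , x₂) x≢0 x≁∞ with x₂ ≟ 0#
  ... | yes refl = ⊥-elim (x≁∞ (x₁ , x₁≢0 , cong₂ _,_ (sym (*-identityʳ x₁)) (sym (zeroʳ x₁))))
    where
      x₁≢0 : x₁ ≢ 0#
      x₁≢0 x₁≡0 = x≢0 (cong (_, 0#) x₁≡0)
  ... | no x₂≢0 = x₁ * inv x₂ x₂≢0 , x₂ , x₂≢0 , cong₂ _,_ (sym x₂[x₁/x₂]≡x₁) (sym (*-identityʳ x₂))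
    where
      x₂[x₁/x₂]≡x₁ : x₂ * (x₁ * inv x₂ x₂≢0) ≡ x₁
      x₂[x₁/x₂]≡x₁ = trans (cong (x₂ *_) (*-comm x₁ _)) (*-inv-cancelˡ x₂≢0 x₁)

  module _ {K : Carrier → Set} (K-subfield : IsSubfield F K) (μ : Carrier) where
    open IsSubfield K-subfield

    1μ-independent : DecidableEquality Carrier → ¬ K μ → Independent F (F1 F) K (1# ∷ μ ∷ [])
    1μ-independent _≟_ μ∉K c c∈K c·[1,μ]≡0 with c (suc zero) ≟ 0#
    ... | yes c₁≡0 = λ { zero → c₀≡0 ; (suc zero) → c₁≡0 }
      where
        c₀≡0 : c zero ≡ 0#
        c₀≡0 = trans (solve 2 (λ a m → a := a :* :1 :+ (:0 :* m :+ :0)) refl (c zero) μ)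
                 (trans (cong (λ b → c zero * 1# + (b * μ + 0#)) (sym c₁≡0)) c·[1,μ]≡0)
    ... | no c₁≢0 = ⊥-elim (μ∉K (subst K (sym μ≡-c₀/c₁)
                      (*-closed (inv-closed (c∈K (suc zero)) (*-inverseʳ c₁≢0)) (neg-closed (c∈K zero)))))
      where
        c₁μ≡-c₀ : c (suc zero) * μ ≡ - c zero
        c₁μ≡-c₀ = +-inverseʳ-unique (c zero) _
          (trans (cong₂ _+_ (sym (*-identityʳ (c zero))) (sym (+-identityʳ _))) c·[1,μ]≡0)

        μ≡-c₀/c₁ : μ ≡ inv (c (suc zero)) c₁≢0 * - c zero
        μ≡-c₀/c₁ = trans (sym (inv-*-cancelˡ c₁≢0 μ)) (cong (inv (c (suc zero)) c₁≢0 *_) c₁μ≡-c₀)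

    independent-pair-spans-span1μ : ∀ {t : Fin 2 → Carrier} → (∀ i → span1μ F K μ (t i)) →
                                    Independent F (F1 F) K t → Spans F (F1 F) K (span1μ F K μ) t
    independent-pair-spans-span1μ {t} t∈T t-independent with t∈T zero | t∈T (suc zero)
    ... | a₀ , b₀ , a₀∈K , b₀∈K , t₀≡ | a₁ , b₁ , a₁∈K , b₁∈K , t₁≡ = spans
      where
        t₀ t₁ : Carrier
        t₀ = t zero
        t₁ = t (suc zero)

        D : Carrier
        D = a₀ * b₁ + - (a₁ * b₀)

        [b₁,-b₀]·t≡D : lincomb F (F1 F) K (b₁ ∷ - b₀ ∷ []) t ≡ D
        [b₁,-b₀]·t≡D = trans (cong₂ (λ u v → b₁ * u + (- b₀ * v + 0#)) t₀≡ t₁≡)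
          (solve 5 (λ a₀ b₀ a₁ b₁ μ → b₁ :* (a₀ :+ b₀ :* μ) :+ ((:- b₀) :* (a₁ :+ b₁ :* μ) :+ :0)
                                        := a₀ :* b₁ :+ :- (a₁ :* b₀)) refl a₀ b₀ a₁ b₁ μ)

        [-a₁,a₀]·t≡Dμ : lincomb F (F1 F) K (- a₁ ∷ a₀ ∷ []) t ≡ D * μ
        [-a₁,a₀]·t≡Dμ = trans (cong₂ (λ u v → - a₁ * u + (a₀ * v + 0#)) t₀≡ t₁≡)
          (solve 5 (λ a₀ b₀ a₁ b₁ μ → (:- a₁) :* (a₀ :+ b₀ :* μ) :+ (a₀ :* (a₁ :+ b₁ :* μ) :+ :0)
                                        := (a₀ :* b₁ :+ :- (a₁ :* b₀)) :* μ) refl a₀ b₀ a₁ b₁ μ)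

        D∈K : K D
        D∈K = +-closed (*-closed a₀∈K b₁∈K) (neg-closed (*-closed a₁∈K b₀∈K))

        D≢0 : D ≢ 0#
        D≢0 D≡0 = 0≢1 (sym (t-independent (1# ∷ 0# ∷ []) (λ { zero → 1∈ ; (suc zero) → 0∈ }) [1,0]·t≡0 zero))
          where
            b₀≡0 : b₀ ≡ 0#
            b₀≡0 = -‿injective (trans (t-independent (b₁ ∷ - b₀ ∷ []) (λ { zero → b₁∈K ; (suc zero) → neg-closed b₀∈K })
                                         (trans [b₁,-b₀]·t≡D D≡0) (suc zero))
                                      (sym -0#≈0#))

            a₀≡0 : a₀ ≡ 0#
            a₀≡0 = t-independent (- a₁ ∷ a₀ ∷ []) (λ { zero → neg-closed a₁∈K ; (suc zero) → a₀∈K })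
                     (trans [-a₁,a₀]·t≡Dμ (trans (cong (_* μ) D≡0) (zeroˡ μ))) (suc zero)

            t₀≡0 : t₀ ≡ 0#
            t₀≡0 = trans t₀≡ (trans (cong₂ (λ a b → a + b * μ) a₀≡0 b₀≡0) (solve 1 (λ μ → :0 :+ :0 :* μ := :0) refl μ))

            [1,0]·t≡0 : lincomb F (F1 F) K (1# ∷ 0# ∷ []) t ≡ 0#
            [1,0]·t≡0 = trans (cong (λ u → 1# * u + (0# * t₁ + 0#)) t₀≡0)
                          (solve 1 (λ t₁ → :1 :* :0 :+ (:0 :* t₁ :+ :0) := :0) refl t₁)

        D⁻¹ : Carrier
        D⁻¹ = inv D D≢0

        D⁻¹∈K : K D⁻¹
        D⁻¹∈K = inv-closed D∈K (*-inverseʳ D≢0)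

        -- Cramer's rule: 1 = D⁻¹ (b₁ t₀ − b₀ t₁) and μ = D⁻¹ (a₀ t₁ − a₁ t₀).
        spans : Spans F (F1 F) K (span1μ F K μ) t
        spans z (a , b , a∈K , b∈K , z≡a+bμ) = c , c∈K , (begin
          c zero * t₀ + (c (suc zero) * t₁ + 0#)
            ≡⟨ solve 9 (λ d a b a₀ a₁ b₀ b₁ t₀ t₁ →
                 d :* (a :* b₁ :+ :- (b :* a₁)) :* t₀ :+ (d :* (b :* a₀ :+ :- (a :* b₀)) :* t₁ :+ :0)
                 := d :* (a :* (b₁ :* t₀ :+ ((:- b₀) :* t₁ :+ :0)) :+ b :* ((:- a₁) :* t₀ :+ (a₀ :* t₁ :+ :0))))
                 refl D⁻¹ a b a₀ a₁ b₀ b₁ t₀ t₁ ⟩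
          D⁻¹ * (a * lincomb F (F1 F) K (b₁ ∷ - b₀ ∷ []) t + b * lincomb F (F1 F) K (- a₁ ∷ a₀ ∷ []) t)
            ≡⟨ cong₂ (λ u v → D⁻¹ * (a * u + b * v)) [b₁,-b₀]·t≡D [-a₁,a₀]·t≡Dμ ⟩
          D⁻¹ * (a * D + b * (D * μ))
            ≡⟨ solve 5 (λ d D a b μ → d :* (a :* D :+ b :* (D :* μ)) := (d :* D) :* (a :+ b :* μ)) refl D⁻¹ D a b μ ⟩
          (D⁻¹ * D) * (a + b * μ)
            ≡⟨ cong₂ _*_ (*-inverseˡ D≢0) (sym z≡a+bμ) ⟩
          1# * z
            ≡⟨ *-identityˡ z ⟩
          z ∎)
          where
            open ≡-Reasoning
            c : Fin 2 → Carrier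
            c = D⁻¹ * (a * b₁ + - (b * a₁)) ∷ D⁻¹ * (b * a₀ + - (a * b₀)) ∷ []

            c∈K : ∀ i → K (c i)
            c∈K zero = *-closed D⁻¹∈K (+-closed (*-closed a∈K b₁∈K) (neg-closed (*-closed b∈K a₁∈K)))
            c∈K (suc zero) = *-closed D⁻¹∈K (+-closed (*-closed b∈K a₀∈K) (neg-closed (*-closed a∈K b₀∈K)))

    1∈span1μ : span1μ F K μ 1#
    1∈span1μ = 1# , 0# , 1∈ , 0∈ , solve 1 (λ μ → :1 := :1 :+ :0 :* μ) refl μ

    μ∈span1μ : span1μ F K μ μ
    μ∈span1μ = 0# , 1# , 0∈ , 1∈ , solve 1 (λ μ → μ := :0 :+ :1 :* μ) refl μ

    module _ {S : Carrier → Set} (S-subspace : IsSubspace F (F1 F) K S) where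

      ∈⇒weight-two : Independent F (F1 F) K (1# ∷ μ ∷ []) → ∀ {l} → S l → S (μ * l) →
                        HasWeight F K (_×ˢ_ F S (span1μ F K μ)) (l , 1#) 2
      ∈⇒weight-two 1μ-independent {l} l∈S μl∈S = w , w∈ , w-independent , w-spans
        where
          t : Fin 2 → Carrier
          t = 1# ∷ μ ∷ []

          w : Fin 2 → V2 F
          w i = _·_ F (t i) (l , 1#)

          w∈ : ∀ i → _×ˢ_ F S (span1μ F K μ) (w i) × FSpan F (l , 1#) (w i)
          w∈ zero = (subst S (sym (*-identityˡ l)) l∈S , subst (span1μ F K μ) (sym (*-identityˡ 1#)) 1∈span1μ) , 1# , refl
          w∈ (suc zero) = (μl∈S , subst (span1μ F K μ) (sym (*-identityʳ μ)) μ∈span1μ) , μ , refl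

          w-independent : Independent F (F2 F) K w
          w-independent c c∈K c·w≡0 = 1μ-independent c c∈K
            (trans (sym (*-identityʳ _)) (cong proj₂ (trans (sym (lincomb-scaled {K = K} c t (l , 1#) λ _ → refl)) c·w≡0)))

          w-spans : Spans F (F2 F) K (λ u → _×ˢ_ F S (span1μ F K μ) u × FSpan F (l , 1#) u) w
          w-spans (u₁ , u₂) ((_ , a , b , a∈K , b∈K , u₂≡a+bμ) , c , u≡cv) =
            (a ∷ b ∷ []) , (λ { zero → a∈K ; (suc zero) → b∈K }) , (begin
              lincomb F (F2 F) K (a ∷ b ∷ []) w      ≡⟨ lincomb-scaled {K = K} (a ∷ b ∷ []) t (l , 1#) (λ _ → refl) ⟩
              _·_ F (a * 1# + (b * μ + 0#)) (l , 1#) ≡⟨ cong (λ x → _·_ F x (l , 1#)) [a,b]·t≡c ⟩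
              _·_ F c (l , 1#)                       ≡⟨ u≡cv ⟨
              (u₁ , u₂)                              ∎)
            where
              open ≡-Reasoning
              [a,b]·t≡c : a * 1# + (b * μ + 0#) ≡ c
              [a,b]·t≡c = begin
                a * 1# + (b * μ + 0#) ≡⟨ solve 3 (λ a b μ → a :* :1 :+ (b :* μ :+ :0) := a :+ b :* μ) refl a b μ ⟩
                a + b * μ             ≡⟨ u₂≡a+bμ ⟨
                u₂                    ≡⟨ cong proj₂ u≡cv ⟩
                c * 1#                ≡⟨ *-identityʳ c ⟩
                c                     ∎

      weight-two⇒span1μ-multiples-∈ : ∀ {l} → HasWeight F K (_×ˢ_ F S (span1μ F K μ)) (l , 1#) 2 →
                                      ∀ {z} → span1μ F K μ z → S (z * l)
      weight-two⇒span1μ-multiples-∈ {l} (w , w∈ , w-independent , _) {z} z∈T =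
        multiple-∈ (independent-pair-spans-span1μ t∈T t-independent z z∈T)
        where
          t : Fin 2 → Carrier
          t i = proj₁ (proj₂ (w∈ i))

          w≡tv : ∀ i → w i ≡ _·_ F (t i) (l , 1#)
          w≡tv i = proj₂ (proj₂ (w∈ i))

          tl∈S : ∀ i → S (t i * l)
          tl∈S i = subst S (cong proj₁ (w≡tv i)) (proj₁ (proj₁ (w∈ i)))

          t∈T : ∀ i → span1μ F K μ (t i)
          t∈T i = subst (span1μ F K μ) (trans (cong proj₂ (w≡tv i)) (*-identityʳ (t i))) (proj₂ (proj₁ (w∈ i)))

          t-independent : Independent F (F1 F) K t
          t-independent α α∈K α·t≡0 = w-independent α α∈K (begin
            lincomb F (F2 F) K α w                 ≡⟨ lincomb-scaled {K = K} α t (l , 1#) w≡tv ⟩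
            _·_ F (lincomb F (F1 F) K α t) (l , 1#) ≡⟨ cong (λ x → _·_ F x (l , 1#)) α·t≡0 ⟩
            (0# * l , 0# * 1#)                     ≡⟨ cong₂ _,_ (zeroˡ l) (zeroˡ 1#) ⟩
            0V F                                   ∎)
            where open ≡-Reasoning

          multiple-∈ : Σ (Fin 2 → Carrier) (λ c → (∀ i → K (c i)) × lincomb F (F1 F) K c t ≡ z) → S (z * l)
          multiple-∈ (c , c∈K , c·t≡z) =
            subst S (trans (sym (lincomb-*ʳ {K = K} c t l)) (cong (_* l) c·t≡z))
              (lincomb-∈ (F1 F) K S-subspace c (λ i → t i * l) c∈K tl∈S)

      weight-two⇒∈ : ∀ {l} → HasWeight F K (_×ˢ_ F S (span1μ F K μ)) (l , 1#) 2 → S l × S (μ * l)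
      weight-two⇒∈ {l} weight-two =
        subst S (*-identityˡ l) (weight-two⇒span1μ-multiples-∈ weight-two 1∈span1μ) ,
        weight-two⇒span1μ-multiples-∈ weight-two μ∈span1μ

corollary3p5 : (F : Field) → (q n k' : ℕ) → IsPrimePower q → 1 ≤ n → 2 ≤ k' →
    (K : Field.Carrier F → Set) → IsSubfield F K → HasSize K q →
    HasSize {Field.Carrier F} (λ _ → ⊤) (q ^ n) →
    (S : Field.Carrier F → Set) → IsSubspace F (F1 F) K S → HasDim F (F1 F) K S k' →
    (μ : Field.Carrier F) → ¬ K μ →
    (j : ℕ) → HasDim F (F1 F) K (λ x → S x × scaleSet F μ S x) j →
    NumPoints F
      (λ v → HasWeight F K (_×ˢ_ F S (span1μ F K μ)) v 2
           × ¬ Proportional F v (Field.1# F , Field.0# F))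
      (q ^ j)
corollary3p5 F q n k' _ _ _ K K-subfield K-size F-size S S-subspace _ μ μ∉K j S∩μS-dim =
  numPoints-affine F Λ-size
    (λ (μl∈S , μl∈μS) → ∈⇒weight-two F K-subfield μ S-subspace 1μ-independent′ (scaleSet-cancel F μ≢0 μl∈μS) μl∈S ,
                         affine≁∞ F _)
    affine-of-weight-two
  where
    open Field F using (Carrier; 0#; 1#; _*_)

    Λ : Carrier → Set
    Λ l = S (μ * l) × scaleSet F μ S (μ * l)

    Λ-of-∈ : ∀ {l} → S l × S (μ * l) → Λ l
    Λ-of-∈ {l} (l∈S , μl∈S) = μl∈S , l , l∈S , refl

    μ≢0 : μ ≢ 0#
    μ≢0 μ≡0 = μ∉K (subst K (sym μ≡0) (IsSubfield.0∈ K-subfield))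

    1μ-independent′ : Independent F (F1 F) K (1# ∷ μ ∷ [])
    1μ-independent′ = 1μ-independent F K-subfield μ (finite⇒≟ F-size) μ∉K

    Λ-size : HasSize Λ (q ^ j)
    Λ-size = HasSize-scale F μ≢0
      (subspace-size F K-subfield K-size (IsSubspace-∩ F (F1 F) K S-subspace (scaleSet-isSubspace F μ S-subspace)) S∩μS-dim)

    affine-of-weight-two : ∀ x → x ≢ 0V F →
                           HasWeight F K (_×ˢ_ F S (span1μ F K μ)) x 2 × ¬ Proportional F x (1# , 0#) →
                           Σ Carrier λ l → Λ l × Proportional F x (l , 1#)
    affine-of-weight-two x x≢0 (x-weight , x≁∞) = of-representative (affine-representative F (finite⇒≟ F-size) x x≢0 x≁∞)
      where
        of-representative : Σ Carrier (λ l → Proportional F x (l , 1#)) → Σ Carrier λ l → Λ l × Proportional F x (l , 1#)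
        of-representative (l , x∼l) =
          l , Λ-of-∈ (weight-two⇒∈ F K-subfield μ S-subspace (HasWeight-proportional F {K} x∼l x-weight)) , x∼l
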